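{- Let $G$ be a finite simple connected graph on $n+s$ vertices and let $S\subseteq V(G)$ with $|S|=s\geq 1$. Suppose that each non-terminal level with respect to $S$ contains at least $2$ vertices, except the second level, which contains at least $3$ vertices. Then \[ \sigma(S)\leq \begin{cases} \frac{1}{4}(n^2+8), & 2\mid n,\\[2pt] \frac{1}{4}(n^2+7), & 2\nmid n. \end{cases} \]
   Context: For $u\in V(G)$, $d_G(S,u)=\min\{d_G(u,v): v\in S\}$, where $d_G$ is the graph distance. The status of $S$ is $\sigma(S)=\sigma_G(S)=\sum_{u\in V(G)} d_G(S,u)$. For $i\geq 1$, the $i$-th level with respect to $S$ is the set of vertices at distance exactly $i$ from $S$; the terminal level is the farthest (largest $i$) nonempty level, and the non-terminal levels are the nonempty levels $i\geq 1$ other than the terminal one. -}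

module Defs where

open import Level using (0ℓ)
open import Data.Nat using (ℕ; zero; suc; _≤_; _<_)
open import Data.Fin using (Fin)
open import Data.Fin.Subset using (Subset; _∈_)
open import Data.Product using (Σ; _×_; ∃)
open import Data.Vec using (tabulate)
open import Data.Vec using () renaming (sum to vsum)
open import Relation.Nullary using (¬_; does)
open import Relation.Binary.PropositionalEquality using (_≡_)
open import Data.Nat using (_≟_)

record SimpleGraph (m : ℕ) : Set₁ where
  field
    Adj     : Fin m → Fin m → Set
    sym     : ∀ {u v} → Adj u v → Adj v u
    irrefl  : ∀ {u} → ¬ Adj u u

open SimpleGraph public

data Walk {m : ℕ} (G : SimpleGraph m) : Fin m → Fin m → ℕ → Set where
  here : ∀ {u} → Walk G u u zero
  step : ∀ {u v w k} → Adj G u v → Walk G v w k → Walk G u w (suc k)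

Connected : ∀ {m} → SimpleGraph m → Set
Connected G = ∀ u v → ∃ λ k → Walk G u v k

IsDist : ∀ {m} → SimpleGraph m → Fin m → Fin m → ℕ → Set
IsDist G u v k = Walk G u v k × (∀ j → j < k → ¬ Walk G u v j)

IsSetDist : ∀ {m} → SimpleGraph m → Subset m → Fin m → ℕ → Set
IsSetDist G S u k =
  (∃ λ v → v ∈ S × IsDist G u v k) ×
  (∀ v j → v ∈ S → IsDist G u v j → k ≤ j)

status : ∀ {m} → (Fin m → ℕ) → ℕ
status d = vsum (tabulate d)

level : ∀ {m} → (Fin m → ℕ) → ℕ → Subset m
level d i = tabulate (λ u → does (d u ≟ i))

NonTerminal : ∀ {m} → (Fin m → ℕ) → ℕ → Set
NonTerminal d i = (1 ≤ i) × (∃ λ u → d u ≡ i) × (∃ λ u → i < d u)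

-- Write N j for the number of vertices at distance at least j from S. Peeling off one
-- layer at a time, σ(S) = N 1 + N 2 + N 3 + ⋯. The vertices of S lie at distance 0, so
-- N 1 ≤ n. Distances to S have no gaps (a shortest walk to S passes through every smaller
-- distance), so whenever N (j + 1) > 0 the level j is non-terminal and
-- N (j + 1) = N j − |level j| ≤ N j − c_j with c_2 = 3 and c_j = 2 otherwise. Hence
-- σ(S) ≤ n + (n − 2) + ((n − 5) + (n − 7) + ⋯), and 4 ((n − 5) + (n − 7) + ⋯) ≤ (n − 4)²
-- gives 4 σ(S) ≤ n² + 8. For odd n, n² + 8 ≡ 1 (mod 4), so the bound drops to n² + 7.
module Submission where

open import Defs hiding (sym)
open import Data.Nat using (ℕ; zero; suc; pred; _+_; _*_; _∸_; _≤_; _<_; z≤n; s≤s; _≤?_; _≟_)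
open import Data.Nat.Properties
open import Data.Nat.Divisibility using (_∣_; m%n≡0⇒n∣m)
open import Data.Nat.DivMod using (_%_; _/_; m≡m%n+[m/n]*n; m%n<n)
open import Data.Nat.Induction using (<-rec)
open import Data.Nat.Solver using (module +-*-Solver)
open import Algebra.Properties.CommutativeSemigroup +-commutativeSemigroup using (x∙yz≈y∙xz)
open import Data.Bool using (true; T)
open import Data.Unit using (tt)
open import Data.Fin using (Fin; zero; suc)
open import Data.Fin.Subset using (Subset; ∣_∣; _∈_; ∁; _⊆_)
open import Data.Fin.Subset.Properties using (p⊆q⇒∣p∣≤∣q∣; ∣∁p∣≡n∸∣p∣; x∉p⇒x∈∁p; nonempty?; Empty-unique; ∣⊥∣≡0)
open import Data.Vec using (_∷_; tabulate)
open import Data.Vec.Properties using (tabulate-cong; lookup∘tabulate; []=⇒lookup)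
open import Data.Product using (_×_; ∃; _,_; proj₁; proj₂)
open import Function using (_∘_)
open import Relation.Binary using (tri<; tri≈; tri>)
open import Relation.Nullary using (¬_; does; yes; no; contradiction)
open import Relation.Nullary.Decidable using (dec-true; dec-false; decidable-stable)
open import Relation.Binary.PropositionalEquality
  using (_≡_; _≢_; refl; sym; trans; cong; subst; subst₂; module ≡-Reasoning)

open +-*-Solver using (solve; _:+_; _:*_; _:=_; con)

staircase : ℕ → ℕ
staircase zero = zero
staircase (suc zero) = 1
staircase (suc (suc x)) = suc (suc x) + staircase x

staircase-unfold : ∀ x → staircase x ≡ x + staircase (x ∸ 2)
staircase-unfold zero = refl
staircase-unfold (suc zero) = refl
staircase-unfold (suc (suc x)) = refl

4*staircase≤[1+x]² : ∀ x → 4 * staircase x ≤ suc x * suc x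
4*staircase≤[1+x]² zero = z≤n
4*staircase≤[1+x]² (suc zero) = ≤-refl
4*staircase≤[1+x]² (suc (suc x)) = begin
  4 * (2 + x + staircase x)        ≡⟨ *-distribˡ-+ 4 (2 + x) (staircase x) ⟩
  4 * (2 + x) + 4 * staircase x    ≤⟨ +-monoʳ-≤ (4 * (2 + x)) (4*staircase≤[1+x]² x) ⟩
  4 * (2 + x) + suc x * suc x      ≡⟨ solve 1 (λ x → con 4 :* (con 2 :+ x) :+ (con 1 :+ x) :* (con 1 :+ x)
                                                   := (con 3 :+ x) :* (con 3 :+ x)) refl x ⟩
  (3 + x) * (3 + x)                ∎
  where open ≤-Reasoning

statusBound : ℕ → ℕ
statusBound n = n + (n ∸ 2 + staircase (n ∸ 5))

4*statusBound≤n²+8 : ∀ n → 4 * statusBound n ≤ n * n + 8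
4*statusBound≤n²+8 0 = z≤n
4*statusBound≤n²+8 1 = ≤ᵇ⇒≤ 4 9 tt
4*statusBound≤n²+8 2 = ≤ᵇ⇒≤ 8 12 tt
4*statusBound≤n²+8 3 = ≤ᵇ⇒≤ 16 17 tt
4*statusBound≤n²+8 4 = ≤-refl
4*statusBound≤n²+8 (suc (suc (suc (suc (suc x))))) = begin
  4 * (5 + x + (3 + x + staircase x))  ≡⟨ solve 2 (λ x s → con 4 :* (con 5 :+ x :+ (con 3 :+ x :+ s))
                                                       := con 4 :* s :+ (con 32 :+ con 8 :* x)) refl x (staircase x) ⟩
  4 * staircase x + (32 + 8 * x)       ≤⟨ +-monoˡ-≤ (32 + 8 * x) (4*staircase≤[1+x]² x) ⟩
  suc x * suc x + (32 + 8 * x)         ≡⟨ solve 1 (λ x → (con 1 :+ x) :* (con 1 :+ x) :+ (con 32 :+ con 8 :* x)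
                                                   := (con 5 :+ x) :* (con 5 :+ x) :+ con 8) refl x ⟩
  (5 + x) * (5 + x) + 8                ∎
  where open ≤-Reasoning

¬2∣n⇒n≡1+[n/2]*2 : ∀ {n} → ¬ 2 ∣ n → n ≡ suc (n / 2 * 2)
¬2∣n⇒n≡1+[n/2]*2 {n} 2∤n with n % 2 in n%2≡r | m%n<n n 2
... | 0 | _ = contradiction (m%n≡0⇒n∣m n 2 n%2≡r) 2∤n
... | 1 | _ = trans (m≡m%n+[m/n]*n n 2) (cong (_+ n / 2 * 2) n%2≡r)
... | suc (suc _) | s≤s (s≤s ())

4*m≤4*k+1⇒4*m≤4*k : ∀ m k → 4 * m ≤ 4 * k + 1 → 4 * m ≤ 4 * k
4*m≤4*k+1⇒4*m≤4*k m k 4m≤4k+1 = *-monoʳ-≤ 4 (m<1+n⇒m≤n (*-cancelˡ-< 4 m (suc k) 4m<4[k+1]))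
  where
  4m<4[k+1] : 4 * m < 4 * suc k
  4m<4[k+1] = begin-strict
    4 * m      ≤⟨ 4m≤4k+1 ⟩
    4 * k + 1  <⟨ +-monoʳ-< (4 * k) (≤ᵇ⇒≤ 2 4 tt) ⟩
    4 * k + 4  ≡⟨ +-comm (4 * k) 4 ⟩
    4 + 4 * k  ≡⟨ *-suc 4 k ⟨
    4 * suc k  ∎
    where open ≤-Reasoning

4*statusBound≤n²+7 : ∀ n → ¬ 2 ∣ n → 4 * statusBound n ≤ n * n + 7
4*statusBound≤n²+7 n 2∤n = begin
  4 * statusBound n  ≤⟨ 4*m≤4*k+1⇒4*m≤4*k (statusBound n) k 4*statusBound≤4k+1 ⟩
  4 * k              ≡⟨ sym n²+7≡4k ⟩
  n * n + 7          ∎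
  where
  open ≤-Reasoning
  q = n / 2
  k = q * q + q + 2
  n²+7≡4k : n * n + 7 ≡ 4 * k
  n²+7≡4k = trans (cong (λ m → m * m + 7) (¬2∣n⇒n≡1+[n/2]*2 2∤n))
    (solve 1 (λ q → (con 1 :+ q :* con 2) :* (con 1 :+ q :* con 2) :+ con 7 := con 4 :* (q :* q :+ q :+ con 2)) refl q)
  4*statusBound≤4k+1 : 4 * statusBound n ≤ 4 * k + 1
  4*statusBound≤4k+1 = ≤-trans (4*statusBound≤n²+8 n)
    (≤-reflexive (trans (sym (+-assoc (n * n) 7 1)) (cong (_+ 1) n²+7≡4k)))

atLeast : ∀ {m} → (Fin m → ℕ) → ℕ → Subset m
atLeast d j = tabulate (λ u → does (j ≤? d u))

NoGaps : ∀ {m} → (Fin m → ℕ) → Set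
NoGaps d = ∀ u j → j ≤ d u → ∃ λ v → d v ≡ j

∈atLeast⇒≤ : ∀ {m} (d : Fin m → ℕ) {j u} → u ∈ atLeast d j → j ≤ d u
∈atLeast⇒≤ d {j} {u} u∈ = ≤ᵇ⇒≤ j (d u) (subst T (sym does≡true) tt)
  where
  does≡true : does (j ≤? d u) ≡ true
  does≡true = trans (sym (lookup∘tabulate (λ v → does (j ≤? d v)) u)) ([]=⇒lookup u∈)

∣atLeast∣-split : ∀ {m} (d : Fin m → ℕ) j → ∣ atLeast d j ∣ ≡ ∣ level d j ∣ + ∣ atLeast d (suc j) ∣
∣atLeast∣-split {zero} d j = refl
∣atLeast∣-split {suc m} d j = split-∷ (d zero) (atLeast (d ∘ suc) j) (level (d ∘ suc) j) (atLeast (d ∘ suc) (suc j))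
                                (∣atLeast∣-split (d ∘ suc) j)
  where
  split-∷ : ∀ x (p q r : Subset m) → ∣ p ∣ ≡ ∣ q ∣ + ∣ r ∣ →
            ∣ does (j ≤? x) ∷ p ∣ ≡ ∣ does (x ≟ j) ∷ q ∣ + ∣ does (suc j ≤? x) ∷ r ∣
  split-∷ x _ _ _ e with <-cmp x j
  ... | tri< x<j _ _
    rewrite dec-false (j ≤? x) (<⇒≱ x<j) | dec-false (x ≟ j) (<⇒≢ x<j)
          | dec-false (suc j ≤? x) (<⇒≱ (m<n⇒m<1+n x<j)) = e
  ... | tri≈ _ refl _
    rewrite dec-true (x ≤? x) ≤-refl | dec-true (x ≟ x) refl | dec-false (suc x ≤? x) 1+n≰n = cong suc e
  ... | tri> _ _ j<x
    rewrite dec-true (j ≤? x) (<⇒≤ j<x) | dec-false (x ≟ j) (>⇒≢ j<x) | dec-true (suc j ≤? x) j<x =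
    trans (cong suc e) (sym (+-suc _ _))

status-peel : ∀ {m} (d : Fin m → ℕ) → status d ≡ ∣ atLeast d 1 ∣ + status (pred ∘ d)
status-peel {zero} d = refl
status-peel {suc m} d = peel-∷ (d zero) (atLeast (d ∘ suc) 1) (status-peel (d ∘ suc))
  where
  peel-∷ : ∀ x {s s'} (p : Subset m) → s ≡ ∣ p ∣ + s' → x + s ≡ ∣ does (1 ≤? x) ∷ p ∣ + (pred x + s')
  peel-∷ zero _ e = e
  peel-∷ (suc x) {s' = s'} p e = cong suc (trans (cong (x +_) e) (x∙yz≈y∙xz x ∣ p ∣ s'))

status≡0 : ∀ {m} (d : Fin m → ℕ) → ∣ atLeast d 1 ∣ ≡ 0 → status d ≡ 0
status≡0 {zero} d _ = refl
status≡0 {suc m} d = zero-∷ (d zero) (atLeast (d ∘ suc) 1) (status≡0 (d ∘ suc))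
  where
  zero-∷ : ∀ x {s} (p : Subset m) → (∣ p ∣ ≡ 0 → s ≡ 0) → ∣ does (1 ≤? x) ∷ p ∣ ≡ 0 → x + s ≡ 0
  zero-∷ zero _ ih e = ih e
  zero-∷ (suc x) _ _ ()

∣atLeast∘pred∣ : ∀ {m} (d : Fin m → ℕ) j → ∣ atLeast (pred ∘ d) (suc j) ∣ ≡ ∣ atLeast d (2 + j) ∣
∣atLeast∘pred∣ d j = cong ∣_∣ (tabulate-cong (λ u → shift (d u)))
  where
  shift : ∀ x → does (suc j ≤? pred x) ≡ does (2 + j ≤? x)
  shift zero = refl
  shift (suc x) = refl

atLeast-shrinks : ∀ {m} {d : Fin m → ℕ} {j c} → NoGaps d → 1 ≤ j →
                  (NonTerminal d j → c ≤ ∣ level d j ∣) →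
                  ∣ atLeast d (suc j) ∣ ≤ ∣ atLeast d j ∣ ∸ c
atLeast-shrinks {m} {d} {j} {c} noGaps 1≤j c≤level with nonempty? (atLeast d (suc j))
... | no empty = ≤-trans (≤-reflexive (trans (cong ∣_∣ (Empty-unique empty)) (∣⊥∣≡0 m))) z≤n
... | yes (u , u∈) = begin
  ∣ atLeast d (suc j) ∣                         ≡⟨ m+n∸m≡n ∣ level d j ∣ _ ⟨
  ∣ level d j ∣ + ∣ atLeast d (suc j) ∣ ∸ ∣ level d j ∣ ≤⟨ ∸-monoʳ-≤ _ (c≤level nonTerminal) ⟩
  ∣ level d j ∣ + ∣ atLeast d (suc j) ∣ ∸ c      ≡⟨ cong (_∸ c) (∣atLeast∣-split d j) ⟨
  ∣ atLeast d j ∣ ∸ c                            ∎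
  where
  open ≤-Reasoning
  j<du : j < d u
  j<du = ∈atLeast⇒≤ d u∈
  nonTerminal : NonTerminal d j
  nonTerminal = 1≤j , noGaps u j (<⇒≤ j<du) , u , j<du

ShrinksBy2 : ∀ {m} → (Fin m → ℕ) → Set
ShrinksBy2 d = ∀ j → ∣ atLeast d (2 + j) ∣ ≤ ∣ atLeast d (1 + j) ∣ ∸ 2

status≤staircase-step : ∀ {m} (d : Fin m → ℕ) x →
  (∣ atLeast (pred ∘ d) 1 ∣ ≤ x ∸ 2 → ShrinksBy2 (pred ∘ d) → status (pred ∘ d) ≤ staircase (x ∸ 2)) →
  ∣ atLeast d 1 ∣ ≤ x → ShrinksBy2 d → status d ≤ staircase x
status≤staircase-step d x bound size≤x shrinks = begin
  status d                             ≡⟨ status-peel d ⟩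
  ∣ atLeast d 1 ∣ + status (pred ∘ d)  ≤⟨ +-mono-≤ size≤x (bound size'≤x∸2 shrinks') ⟩
  x + staircase (x ∸ 2)                ≡⟨ staircase-unfold x ⟨
  staircase x                          ∎
  where
  open ≤-Reasoning
  size'≤x∸2 : ∣ atLeast (pred ∘ d) 1 ∣ ≤ x ∸ 2
  size'≤x∸2 = subst (_≤ x ∸ 2) (sym (∣atLeast∘pred∣ d 0)) (≤-trans (shrinks 0) (∸-monoˡ-≤ 2 size≤x))
  shrinks' : ShrinksBy2 (pred ∘ d)
  shrinks' j = subst₂ (λ a b → a ≤ b ∸ 2) (sym (∣atLeast∘pred∣ d (suc j))) (sym (∣atLeast∘pred∣ d j)) (shrinks (suc j))

status≤staircase : ∀ {m} (d : Fin m → ℕ) x → ∣ atLeast d 1 ∣ ≤ x → ShrinksBy2 d → status d ≤ staircase x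
status≤staircase d zero size≤0 _ = ≤-reflexive (status≡0 d (n≤0⇒n≡0 size≤0))
status≤staircase d (suc zero) = status≤staircase-step d 1 (status≤staircase (pred ∘ d) 0)
status≤staircase d (suc (suc x)) = status≤staircase-step d (2 + x) (status≤staircase (pred ∘ d) x)

status≤statusBound : ∀ {m} n (d : Fin m → ℕ) → NoGaps d → ∣ atLeast d 1 ∣ ≤ n →
  (∀ i → NonTerminal d i → i ≢ 2 → 2 ≤ ∣ level d i ∣) →
  (∀ i → NonTerminal d i → i ≡ 2 → 3 ≤ ∣ level d i ∣) →
  status d ≤ statusBound n
status≤statusBound n d noGaps size₁≤n large₂ large₃ = begin
  status d                                          ≡⟨ status-peel d ⟩
  ∣ atLeast d 1 ∣ + status (pred ∘ d)               ≡⟨ cong (∣ atLeast d 1 ∣ +_) (status-peel (pred ∘ d)) ⟩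
  ∣ atLeast d 1 ∣ + (∣ atLeast (pred ∘ d) 1 ∣ + status d″)
                                                    ≡⟨ cong (λ a → ∣ atLeast d 1 ∣ + (a + status d″)) (∣atLeast∘pred∣ d 0) ⟩
  ∣ atLeast d 1 ∣ + (∣ atLeast d 2 ∣ + status d″)
    ≤⟨ +-mono-≤ size₁≤n (+-mono-≤ size₂≤n∸2 (status≤staircase d″ (n ∸ 5) size₃≤n∸5 shrinks″)) ⟩
  statusBound n                                     ∎
  where
  open ≤-Reasoning
  d″ : _ → ℕ
  d″ = pred ∘ pred ∘ d
  ∣atLeast∘pred²∣ : ∀ j → ∣ atLeast d″ (suc j) ∣ ≡ ∣ atLeast d (3 + j) ∣
  ∣atLeast∘pred²∣ j = trans (∣atLeast∘pred∣ (pred ∘ d) j) (∣atLeast∘pred∣ d (suc j))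
  size₂≤n∸2 : ∣ atLeast d 2 ∣ ≤ n ∸ 2
  size₂≤n∸2 = ≤-trans (atLeast-shrinks noGaps ≤-refl (λ nt → large₂ 1 nt λ ())) (∸-monoˡ-≤ 2 size₁≤n)
  size₃≤n∸5 : ∣ atLeast d″ 1 ∣ ≤ n ∸ 5
  size₃≤n∸5 = subst₂ _≤_ (sym (∣atLeast∘pred²∣ 0)) (∸-+-assoc n 2 3)
    (≤-trans (atLeast-shrinks noGaps (s≤s z≤n) (λ nt → large₃ 2 nt refl)) (∸-monoˡ-≤ 3 size₂≤n∸2))
  shrinks″ : ShrinksBy2 d″
  shrinks″ j = subst₂ (λ a b → a ≤ b ∸ 2) (sym (∣atLeast∘pred²∣ (suc j))) (sym (∣atLeast∘pred²∣ j))
    (atLeast-shrinks noGaps (s≤s z≤n) (λ nt → large₂ (3 + j) nt λ ()))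

∣atLeast1∣≤m∸∣S∣ : ∀ {m} (d : Fin m → ℕ) (S : Subset m) → (∀ {u} → u ∈ S → d u ≡ 0) →
                  ∣ atLeast d 1 ∣ ≤ m ∸ ∣ S ∣
∣atLeast1∣≤m∸∣S∣ {m} d S S⇒d≡0 = begin
  ∣ atLeast d 1 ∣  ≤⟨ p⊆q⇒∣p∣≤∣q∣ atLeast1⊆∁S ⟩
  ∣ ∁ S ∣          ≡⟨ ∣∁p∣≡n∸∣p∣ S ⟩
  m ∸ ∣ S ∣        ∎
  where
  open ≤-Reasoning
  atLeast1⊆∁S : atLeast d 1 ⊆ ∁ S
  atLeast1⊆∁S u∈ = x∉p⇒x∈∁p (λ u∈S → 1+n≰n (subst (1 ≤_) (S⇒d≡0 u∈S) (∈atLeast⇒≤ d u∈)))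

-- A shortest walk cannot be extracted constructively, only shown not to be absent; this
-- suffices below because the inequalities being proved are decidable.
walk⇒¬¬dist : ∀ {m} {G : SimpleGraph m} {u v} k → Walk G u v k → ¬ (∀ j → j ≤ k → ¬ IsDist G u v j)
walk⇒¬¬dist {G = G} {u} {v} = <-rec (λ k → Walk G u v k → ¬ (∀ j → j ≤ k → ¬ IsDist G u v j)) shortening
  where
  shortening : ∀ k → (∀ {j} → j < k → Walk G u v j → ¬ (∀ i → i ≤ j → ¬ IsDist G u v i)) →
               Walk G u v k → ¬ (∀ j → j ≤ k → ¬ IsDist G u v j)
  shortening k shorter walk noDist = noDist k ≤-refl (walk , λ j j<k walk′ →
    shorter j<k walk′ (λ i i≤j → noDist i (≤-trans i≤j (<⇒≤ j<k))))

module _ {m} {G : SimpleGraph m} {S : Subset m} {d : Fin m → ℕ}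
         (isSetDist : ∀ u → IsSetDist G S u (d u)) where

  d≤length : ∀ {u v k} → v ∈ S → Walk G u v k → d u ≤ k
  d≤length {u} {v} {k} v∈S walk = decidable-stable (d u ≤? k) λ du≰k →
    walk⇒¬¬dist k walk (λ j j≤k dist → du≰k (≤-trans (proj₂ (isSetDist u) v j v∈S dist) j≤k))

  ∈S⇒d≡0 : ∀ {u} → u ∈ S → d u ≡ 0
  ∈S⇒d≡0 u∈S = n≤0⇒n≡0 (d≤length u∈S here)

  d≡suc⇒∃pred : ∀ u {k} → d u ≡ suc k → ∃ λ w → d w ≡ k
  d≡suc⇒∃pred u {k} du≡1+k with proj₁ (isSetDist u)
  ... | v , v∈S , walk , _ with subst (Walk G u v) du≡1+k walk
  ... | step {v = w} u~w rest = w , ≤-antisym (d≤length v∈S rest) (≤-pred 1+k≤1+dw)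
    where
    1+k≤1+dw : suc k ≤ suc (d w)
    1+k≤1+dw with proj₁ (isSetDist w)
    ... | v′ , v′∈S , walk′ , _ = subst (_≤ suc (d w)) du≡1+k (d≤length v′∈S (step u~w walk′))

  noGaps : NoGaps d
  noGaps u j j≤du = descend (d u ∸ j) u (sym (m∸n+n≡m j≤du))
    where
    descend : ∀ t u → d u ≡ t + j → ∃ λ v → d v ≡ j
    descend zero u du≡j = u , du≡j
    descend (suc t) u du≡1+t+j with d≡suc⇒∃pred u du≡1+t+j
    ... | w , dw≡t+j = descend t w dw≡t+j

lemma4 : (n s : ℕ) (G : SimpleGraph (n + s)) → Connected G →
         (S : Subset (n + s)) → ∣ S ∣ ≡ s → 1 ≤ s →
         (d : _ → ℕ) → (∀ u → IsSetDist G S u (d u)) →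
         (∀ i → NonTerminal d i → i ≢ 2 → 2 ≤ ∣ level d i ∣) →
         (∀ i → NonTerminal d i → i ≡ 2 → 3 ≤ ∣ level d i ∣) →
         ((2 ∣ n → 4 * status d ≤ n * n + 8) ×
          (¬ (2 ∣ n) → 4 * status d ≤ n * n + 7))
lemma4 n s G _ S ∣S∣≡s _ d isSetDist large₂ large₃ =
  (λ _ → ≤-trans 4*status≤4*bound (4*statusBound≤n²+8 n)) ,
  (λ 2∤n → ≤-trans 4*status≤4*bound (4*statusBound≤n²+7 n 2∤n))
  where
  size₁≤n : ∣ atLeast d 1 ∣ ≤ n
  size₁≤n = subst (∣ atLeast d 1 ∣ ≤_) (trans (cong (n + s ∸_) ∣S∣≡s) (m+n∸n≡m n s))
              (∣atLeast1∣≤m∸∣S∣ d S (∈S⇒d≡0 isSetDist))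
  4*status≤4*bound : 4 * status d ≤ 4 * statusBound n
  4*status≤4*bound = *-monoʳ-≤ 4 (status≤statusBound n d (noGaps isSetDist) size₁≤n large₂ large₃)
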